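{- Let $G=(V,E)$ be a 3-edge-connected graph with at least two vertices, and let $T$ be a spanning tree of $G$. Then there exist two fundamental cycles of $T$ whose intersection consists of exactly one edge, and this edge lies in $T$.
   Context: Graphs may have loops and parallel edges. A cycle is a connected subgraph in which every vertex has degree two, regarded as an edge set. For $e\in E\setminus T$ the fundamental cycle $\mathrm{ci}(e,T)$ is the unique cycle contained in $T\cup\{e\}$. A graph is 3-edge-connected if it is connected and remains connected after deleting any at most two edges. -}

module Defs where

open import Data.Nat using (ℕ; zero; suc; _+_; _≤_)
open import Data.Fin using (Fin; _≟_)
open import Data.Fin.Subset using (Subset; _∈_; _∉_; _⊆_; _∪_; _∩_; ⁅_⁆; ⊤; _─_; ∣_∣)
open import Data.List using (List; map; allFin)
open import Data.Nat.ListAction using (sum)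
open import Data.Product using (Σ; _×_; _,_; ∃; proj₁; proj₂)
open import Data.Sum using (_⊎_)
open import Relation.Binary.PropositionalEquality using (_≡_)
open import Relation.Nullary.Decidable using (⌊_⌋)
open import Data.Bool using (Bool; true; false; if_then_else_)

-- A finite multigraph: vertices Fin n, edges Fin m, each edge has two
-- (unordered) endpoints; loops (equal endpoints) and parallel edges allowed.
record Graph : Set where
  field
    n    : ℕ
    m    : ℕ
    ends : Fin m → Fin n × Fin n

module _ (G : Graph) where
  open Graph G

  Joins : Fin m → Fin n → Fin n → Set
  Joins e u v = ends e ≡ (u , v) ⊎ ends e ≡ (v , u)

  IncidentTo : Fin n → Fin m → Set
  IncidentTo v e = proj₁ (ends e) ≡ v ⊎ proj₂ (ends e) ≡ v

  data Reach (S : Subset m) (u : Fin n) : Fin n → Set where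
    here : Reach S u u
    step : ∀ {v w} (e : Fin m) → e ∈ S → Joins e v w → Reach S u v → Reach S u w

  ConnectedVia : Subset m → Set
  ConnectedVia S = ∀ u v → Reach S u v

  Connected : Set
  Connected = ConnectedVia ⊤

  ThreeEdgeConnected : Set
  ThreeEdgeConnected =
    Connected × (∀ (F : Subset m) → ∣ F ∣ ≤ 2 → ConnectedVia (⊤ ─ F))

  b2n : Bool → ℕ
  b2n true  = 1
  b2n false = 0

  -- number of ends of e equal to v (a loop counts twice)
  endCount : Fin n → Fin m → ℕ
  endCount v e = b2n ⌊ proj₁ (ends e) ≟ v ⌋ + b2n ⌊ proj₂ (ends e) ≟ v ⌋

  inS : Subset m → Fin m → ℕ → ℕ
  inS S e k = if Data.Vec.lookup S e then k else 0
    where import Data.Vec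

  degree : Subset m → Fin n → ℕ
  degree S v = sum (map (λ e → inS S e (endCount v e)) (allFin m))

  IsCycle : Subset m → Set
  IsCycle C =
    (∃ λ e → e ∈ C)
    × (∀ v → degree C v ≡ 0 ⊎ degree C v ≡ 2)
    × (∀ u v e f → e ∈ C → f ∈ C → IncidentTo u e → IncidentTo v f → Reach C u v)

  IsSpanningTree : Subset m → Set
  IsSpanningTree T = ConnectedVia T × (∀ C → C ⊆ T → IsCycle C → Data.Empty.⊥)
    where import Data.Empty

  -- C is the fundamental cycle ci(e,T): e ∉ T and C is the (unique) cycle in T ∪ {e}
  IsFundamentalCycle : Subset m → Fin m → Subset m → Set
  IsFundamentalCycle T e C = e ∉ T × IsCycle C × C ⊆ T ∪ ⁅ e ⁆

-- For a tree edge k, the fundamental cycle ci(e, T) of a non-tree edge e contains k exactly when e crosses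
-- the cut of T − k, and for a fixed root these cuts are nested or disjoint. Pick a tree edge g; by
-- 3-edge-connectivity two distinct non-tree edges e₁, e₂ cross its cut, so ci(e₁) ∩ ci(e₂) contains g, and it
-- contains only tree edges. If it contains two tree edges g and h, a third non-tree edge e₃ leaves the part of the
-- tree between them and crosses exactly one of g, h; the nesting of the cuts then shows that one of the pairs
-- (e₃, e₁), (e₃, e₂) shares a nonempty proper subset of these edges. Descending on the size of the common part
-- ends with two fundamental cycles meeting in exactly one edge, which lies in T.

module Submission where

open import Defs
open import Data.Nat.Properties
  using (+-0-commutativeMonoid; +-comm; +-identityʳ; +-suc; ≤-trans; ≤-reflexive; n≤1+n; +-monoʳ-≤)
open import Algebra.Properties.CommutativeMonoid.Sum +-0-commutativeMonoid
  using (sum-remove; sum-cong-≗; sum-replicate-zero; ∑-distrib-+) renaming (sum to ∑)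
open import Data.Bool as Bool using (Bool; true; false; if_then_else_; _∨_)
open import Data.Bool.Properties using (¬-not)
open import Data.Empty using (⊥; ⊥-elim)
open import Data.Fin using (Fin; zero; suc; punchIn) renaming (_≟_ to _≟ᶠ_)
open import Data.Fin.Properties using (punchInᵢ≢i; any?)
open import Data.Fin.Subset using (Subset; _∈_; _∉_; _⊆_; _⊂_; _∪_; _∩_; ⁅_⁆; _─_; ∣_∣; ⊤; Nonempty; inside; outside)
open import Data.Fin.Subset.Properties using (∣⁅x⁆∣≡1; _∈?_; _⊆?_; ⊆-antisym; p⊂q⇒∣p∣<∣q∣; x∈p∩q⁺; x∈p∩q⁻; x∈p∪q⁺; x∈⁅x⁆; x∈⁅y⁆⇒x≡y)
open import Data.List using (List; []; _∷_; map; allFin; tabulate)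
open import Data.List.Properties using (map-tabulate)
open import Data.List.Membership.Propositional using () renaming (_∈_ to _∈ˡ_)
open import Data.List.Relation.Unary.All using ([])
open import Data.List.Relation.Unary.All.Properties using (All¬⇒¬Any; ¬Any⇒All¬)
open import Data.List.Relation.Unary.Any using (here; there) renaming (any? to anyˡ?)
open import Data.List.Relation.Unary.Unique.Propositional using (Unique; []; _∷_)
open import Data.Nat using (ℕ; zero; suc; _+_; _*_; _≤_; _<_; z≤n; s≤s)
open import Data.Nat.Induction using (<-wellFounded)
open import Data.Nat.ListAction using (sum)
open import Data.Nat.Solver using (module +-*-Solver)
open import Data.Product using (Σ; ∃; ∃₂; _×_; _,_; proj₁; proj₂)
open import Data.Sum using (_⊎_; inj₁; inj₂; [_,_])
open import Data.Vec as Vec using (_∷_)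
open import Data.Vec.Properties using (lookup∘tabulate; lookup⇒[]=; []=⇒lookup)
open import Function using (_∘_; id)
open import Induction.WellFounded using (Acc; acc)
open import Relation.Binary.PropositionalEquality using (_≡_; _≢_; refl; sym; trans; cong; cong₂; subst)
open import Relation.Nullary using (Dec; yes; no; does; ¬_)
open import Relation.Nullary.Decidable using (dec-true; decidable-stable; ⌊_⌋; ¬?; _×-dec_)
open import Relation.Unary using (Decidable)

-- Finite sets and sums

infix 4 _∈ˡ?_

_∈ˡ?_ : ∀ {k} (x : Fin k) (l : List (Fin k)) → Dec (x ∈ˡ l)
x ∈ˡ? l = anyˡ? (x ≟ᶠ_) l

module _ {k} {P : Fin k → Set} (P? : Decidable P) where

  subsetOf : Subset k
  subsetOf = Vec.tabulate (does ∘ P?)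

  ∈-subsetOf⁺ : ∀ {i} → P i → i ∈ subsetOf
  ∈-subsetOf⁺ {i} pi = lookup⇒[]= i subsetOf (trans (lookup∘tabulate _ i) (dec-true (P? i) pi))

  ∈-subsetOf⁻ : ∀ {i} → i ∈ subsetOf → P i
  ∈-subsetOf⁻ {i} i∈ with P? i | trans (sym (lookup∘tabulate (does ∘ P?) i)) ([]=⇒lookup i∈)
  ... | yes pi | _ = pi

∣p∪q∣≤∣p∣+∣q∣ : ∀ {k} (p q : Subset k) → ∣ p ∪ q ∣ ≤ ∣ p ∣ + ∣ q ∣
∣p∪q∣≤∣p∣+∣q∣ Vec.[] Vec.[] = z≤n
∣p∪q∣≤∣p∣+∣q∣ (inside ∷ p) (inside ∷ q) =
  s≤s (≤-trans (∣p∪q∣≤∣p∣+∣q∣ p q) (+-monoʳ-≤ ∣ p ∣ (n≤1+n ∣ q ∣)))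
∣p∪q∣≤∣p∣+∣q∣ (inside ∷ p) (outside ∷ q) = s≤s (∣p∪q∣≤∣p∣+∣q∣ p q)
∣p∪q∣≤∣p∣+∣q∣ (outside ∷ p) (inside ∷ q) =
  ≤-trans (s≤s (∣p∪q∣≤∣p∣+∣q∣ p q)) (≤-reflexive (sym (+-suc ∣ p ∣ ∣ q ∣)))
∣p∪q∣≤∣p∣+∣q∣ (outside ∷ p) (outside ∷ q) = ∣p∪q∣≤∣p∣+∣q∣ p q

∣⁅x⁆∪⁅y⁆∣≤2 : ∀ {k} (x y : Fin k) → ∣ ⁅ x ⁆ ∪ ⁅ y ⁆ ∣ ≤ 2
∣⁅x⁆∪⁅y⁆∣≤2 x y = ≤-trans (∣p∪q∣≤∣p∣+∣q∣ ⁅ x ⁆ ⁅ y ⁆) (≤-reflexive (cong₂ _+_ (∣⁅x⁆∣≡1 x) (∣⁅x⁆∣≡1 y)))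

x∈p─q⇒x∉q : ∀ {k} {x : Fin k} (p q : Subset k) → x ∈ p ─ q → x ∉ q
x∈p─q⇒x∉q {x = zero} (_ ∷ p) (inside ∷ q) () _
x∈p─q⇒x∉q {x = zero} (_ ∷ p) (outside ∷ q) _ ()
x∈p─q⇒x∉q {x = suc x} (_ ∷ p) (_ ∷ q) (Vec.there x∈) (Vec.there x∈q) = x∈p─q⇒x∉q p q x∈ x∈q

exchange : ∀ {k} (A₁ A₂ A₃ : Subset k) →
  (∀ {i j} → i ∈ A₃ ∩ A₁ → i ∉ A₂ → j ∈ A₃ ∩ A₂ → j ∉ A₁ → ⊥) →
  ∀ {y} → y ∈ A₁ ∩ A₂ → y ∉ A₃ → A₃ ∩ A₁ ⊂ A₁ ∩ A₂ ⊎ A₃ ∩ A₂ ⊂ A₁ ∩ A₂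
exchange A₁ A₂ A₃ no-switch {y} y∈ y∉ with A₃ ∩ A₁ ⊆? A₂
... | yes ⊆A₂ = inj₁ ((λ i∈ → x∈p∩q⁺ (proj₂ (x∈p∩q⁻ A₃ A₁ i∈) , ⊆A₂ i∈)) , y , y∈ , y∉ ∘ proj₁ ∘ x∈p∩q⁻ A₃ A₁)
... | no ⊈A₂ = inj₂ (⊆A₁ , y , y∈ , y∉ ∘ proj₁ ∘ x∈p∩q⁻ A₃ A₂)
  where
  ⊆A₁ : A₃ ∩ A₂ ⊆ A₁ ∩ A₂
  ⊆A₁ {j} j∈ = x∈p∩q⁺ (decidable-stable (j ∈? A₁) j∈A₁ , proj₂ (x∈p∩q⁻ A₃ A₂ j∈))
    where
    j∈A₁ : ¬ j ∉ A₁
    j∈A₁ j∉ = ⊈A₂ λ {i} i∈ → decidable-stable (i ∈? A₂) (λ i∉ → no-switch i∈ i∉ j∈ j∉)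

descent : ∀ {A : Set} {P Q : A → Set} (μ : A → ℕ) →
  (∀ {a} → P a → Q a ⊎ ∃ λ b → P b × μ b < μ a) → ∀ {a} → P a → ∃ λ b → P b × Q b
descent {P = P} {Q} μ progress pa = go pa (<-wellFounded _)
  where
  go : ∀ {a} → P a → Acc _<_ (μ a) → ∃ λ b → P b × Q b
  go pa (acc smaller) with progress pa
  ... | inj₁ qa = _ , pa , qa
  ... | inj₂ (b , pb , μb<μa) = go pb (smaller μb<μa)

two-elements : ∀ {k} → 2 ≤ k → Σ (Fin k) λ u → Σ (Fin k) λ v → u ≢ v
two-elements (s≤s (s≤s z≤n)) = zero , suc zero , λ ()

_·_ : Bool → ℕ → ℕ
b · n = if b then n else 0

sum-map-allFin : ∀ {k} (f : Fin k → ℕ) → sum (map f (allFin k)) ≡ ∑ f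
sum-map-allFin f = trans (cong sum (map-tabulate id f)) (sum-tabulate f)
  where
  sum-tabulate : ∀ {j} (g : Fin j → ℕ) → sum (tabulate g) ≡ ∑ g
  sum-tabulate {zero} g = refl
  sum-tabulate {suc j} g = cong (g zero +_) (sum-tabulate (g ∘ suc))

∑-single : ∀ {k} (f : Fin k → ℕ) (x : Fin k) → ∑ (λ i → does (i ≟ᶠ x) · f i) ≡ f x
∑-single {suc k} f x = begin
  ∑ g                          ≡⟨ sum-remove {i = x} g ⟩
  g x + ∑ (g ∘ punchIn x)      ≡⟨ cong₂ _+_ (g-at-x) (sum-cong-≗ {k} g-off-x) ⟩
  f x + ∑ {k} (λ _ → 0)        ≡⟨ cong (f x +_) (sum-replicate-zero k) ⟩
  f x + 0                      ≡⟨ +-identityʳ (f x) ⟩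
  f x ∎
  where
  open Relation.Binary.PropositionalEquality.≡-Reasoning
  g : Fin (suc k) → ℕ
  g i = does (i ≟ᶠ x) · f i
  g-at-x : g x ≡ f x
  g-at-x with x ≟ᶠ x
  ... | yes _ = refl
  ... | no x≢x = ⊥-elim (x≢x refl)
  g-off-x : ∀ j → g (punchIn x j) ≡ 0
  g-off-x j with punchIn x j ≟ᶠ x
  ... | yes eq = ⊥-elim (punchInᵢ≢i x j eq)
  ... | no _ = refl

∑-indicator : ∀ {k} (f : Fin k → ℕ) (l : List (Fin k)) → Unique l →
  ∑ (λ i → does (i ∈ˡ? l) · f i) ≡ sum (map f l)
∑-indicator {k} f [] [] = sum-replicate-zero k
∑-indicator {k} f (x ∷ l) (x∉l ∷ ul) = begin
  ∑ (λ i → does (i ∈ˡ? x ∷ l) · f i)                ≡⟨ sum-cong-≗ {k} indicator-∷ ⟩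
  ∑ (λ i → [x] i + [l] i)                           ≡⟨ ∑-distrib-+ [x] [l] ⟩
  ∑ [x] + ∑ [l]                                     ≡⟨ cong₂ _+_ (∑-single f x) (∑-indicator f l ul) ⟩
  f x + sum (map f l) ∎
  where
  open Relation.Binary.PropositionalEquality.≡-Reasoning
  [x] [l] : Fin k → ℕ
  [x] i = does (i ≟ᶠ x) · f i
  [l] i = does (i ∈ˡ? l) · f i
  indicator-∷ : ∀ i → (does (i ≟ᶠ x) ∨ does (i ∈ˡ? l)) · f i ≡ [x] i + [l] i
  indicator-∷ i with i ≟ᶠ x | i ∈ˡ? l
  ... | yes i≡x | yes i∈l = ⊥-elim (All¬⇒¬Any x∉l (subst (_∈ˡ l) i≡x i∈l))
  ... | yes _ | no _ = sym (+-identityʳ _)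
  ... | no _ | yes _ = refl
  ... | no _ | no _ = refl

-- Walks, paths and the cycles they close

module Walks (G : Graph) where
  open Graph G
  open +-*-Solver
  open Relation.Binary.PropositionalEquality.≡-Reasoning

  data Walk (P : Fin m → Set) (u : Fin n) : Fin n → Set where
    nil  : Walk P u u
    snoc : ∀ {v w} → Walk P u v → (e : Fin m) → P e → Joins G e v w → Walk P u w

  _∖_ : (Fin m → Set) → Fin m → Fin m → Set
  (P ∖ k) e = P e × e ≢ k

  joins-sym : ∀ {e u v} → Joins G e u v → Joins G e v u
  joins-sym (inj₁ eq) = inj₂ eq
  joins-sym (inj₂ eq) = inj₁ eq

  joins-incidentˡ : ∀ {e v w} → Joins G e v w → IncidentTo G v e
  joins-incidentˡ (inj₁ refl) = inj₁ refl
  joins-incidentˡ (inj₂ refl) = inj₂ refl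

  joins-incidentʳ : ∀ {e v w} → Joins G e v w → IncidentTo G w e
  joins-incidentʳ = joins-incidentˡ ∘ joins-sym

  incident-joins : ∀ {e v w z} → Joins G e v w → IncidentTo G z e → z ≡ v ⊎ z ≡ w
  incident-joins (inj₁ refl) (inj₁ refl) = inj₁ refl
  incident-joins (inj₁ refl) (inj₂ refl) = inj₂ refl
  incident-joins (inj₂ refl) (inj₁ refl) = inj₂ refl
  incident-joins (inj₂ refl) (inj₂ refl) = inj₁ refl

  relax : ∀ {P Q : Fin m → Set} {u v} → (∀ {e} → P e → Q e) → Walk P u v → Walk Q u v
  relax f nil = nil
  relax f (snoc p e pe j) = snoc (relax f p) e (f pe) j

  fromReach : ∀ {S u v} → Reach G S u v → Walk (_∈ S) u v
  fromReach here = nil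
  fromReach (step e e∈ j r) = snoc (fromReach r) e e∈ j

  toReach : ∀ {S u v} → Walk (_∈ S) u v → Reach G S u v
  toReach nil = here
  toReach (snoc p e e∈ j) = step e e∈ j (toReach p)

  module _ {P : Fin m → Set} where

    infixr 5 _++_

    _++_ : ∀ {u v w} → Walk P u v → Walk P v w → Walk P u w
    p ++ nil = p
    p ++ snoc q e pe j = snoc (p ++ q) e pe j

    reverse : ∀ {u v} → Walk P u v → Walk P v u
    reverse nil = nil
    reverse (snoc p e pe j) = snoc nil e pe (joins-sym j) ++ reverse p

    vertices : ∀ {u v} → Walk P u v → List (Fin n)
    vertices {u} nil = u ∷ []
    vertices (snoc {w = w} p _ _ _) = w ∷ vertices p

    edges : ∀ {u v} → Walk P u v → List (Fin m)
    edges nil = []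
    edges (snoc p e _ _) = e ∷ edges p

    first∈ : ∀ {u v} (p : Walk P u v) → u ∈ˡ vertices p
    first∈ nil = here refl
    first∈ (snoc p _ _ _) = there (first∈ p)

    last∈ : ∀ {u v} (p : Walk P u v) → v ∈ˡ vertices p
    last∈ nil = here refl
    last∈ (snoc _ _ _ _) = here refl

    edge-satisfies : ∀ {u v e} (p : Walk P u v) → e ∈ˡ edges p → P e
    edge-satisfies (snoc _ _ pe _) (here refl) = pe
    edge-satisfies (snoc p _ _ _) (there e∈) = edge-satisfies p e∈

    incident-vertices : ∀ {u v e z} (p : Walk P u v) → e ∈ˡ edges p → IncidentTo G z e → z ∈ˡ vertices p
    incident-vertices (snoc p _ _ j) (here refl) z∼e with incident-joins j z∼e
    ... | inj₁ refl = there (last∈ p)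
    ... | inj₂ refl = here refl
    incident-vertices (snoc p _ _ _) (there e∈) z∼e = there (incident-vertices p e∈ z∼e)

    prefix : ∀ {u v y} (p : Walk P u v) → y ∈ˡ vertices p → Walk (_∈ˡ edges p) u y
    prefix nil (here refl) = nil
    prefix (snoc p e _ j) (here refl) = snoc (relax there (prefix p (last∈ p))) e (here refl) j
    prefix (snoc p _ _ _) (there y∈) = relax there (prefix p y∈)

    avoiding : ∀ {u v k} (p : Walk P u v) → ¬ k ∈ˡ edges p → Walk (P ∖ k) u v
    avoiding nil _ = nil
    avoiding (snoc p e pe j) k∉ = snoc (avoiding p (k∉ ∘ there)) e (pe , λ { refl → k∉ (here refl) }) j

    split : ∀ {u v k} (p : Walk P u v) → Unique (edges p) → k ∈ˡ edges p →
      ∃₂ λ s t → Joins G k s t × Walk (P ∖ k) u s × Walk (P ∖ k) t v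
    split (snoc p _ _ j) (e∉ ∷ _) (here refl) = _ , _ , j , avoiding p (All¬⇒¬Any e∉) , nil
    split (snoc p e pe j) (e∉ ∷ up) (there k∈) with split p up k∈
    ... | s , t , jk , p₁ , p₂ = s , t , jk , p₁ , snoc p₂ e (pe , λ { refl → All¬⇒¬Any e∉ k∈ }) j

    shortcut : ∀ {u v w} (p : Walk P u v) → Unique (vertices p) → w ∈ˡ vertices p →
      Σ (Walk P u w) (Unique ∘ vertices)
    shortcut nil up (here refl) = nil , up
    shortcut p@(snoc _ _ _ _) up (here refl) = p , up
    shortcut (snoc p _ _ _) (_ ∷ up) (there w∈) = shortcut p up w∈

    first-edge : ∀ {u v} → Walk P u v → u ≢ v → ∃ P
    first-edge nil u≢u = ⊥-elim (u≢u refl)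
    first-edge (snoc _ e pe _) _ = e , pe

    simplify : ∀ {u v} → Walk P u v → Σ (Walk P u v) (Unique ∘ vertices)
    simplify nil = nil , [] ∷ []
    simplify (snoc {w = w} p e pe j) with simplify p
    ... | q , uq with w ∈ˡ? vertices q
    ... | yes w∈ = shortcut q uq w∈
    ... | no w∉ = snoc q e pe j , ¬Any⇒All¬ _ w∉ ∷ uq

    exit-edge : ∀ {M : Fin n → Set} → Decidable M → ∀ {u v} → Walk P u v → M u → ¬ M v →
      ∃ λ e → ∃₂ λ s t → P e × Joins G e s t × M s × ¬ M t
    exit-edge M? nil Mu ¬Mv = ⊥-elim (¬Mv Mu)
    exit-edge M? (snoc {v = w} p e pe j) Mu ¬Mv with M? w
    ... | yes Mw = e , w , _ , pe , j , Mw , ¬Mv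
    ... | no ¬Mw = exit-edge M? p Mu ¬Mw

    unique-edges : ∀ {u v} (p : Walk P u v) → Unique (vertices p) → Unique (edges p)
    unique-edges nil _ = []
    unique-edges (snoc p _ _ j) (w∉ ∷ up) =
      ¬Any⇒All¬ _ (λ e∈ → All¬⇒¬Any w∉ (incident-vertices p e∈ (joins-incidentʳ j))) ∷ unique-edges p up

  hits : Fin n → Fin n → ℕ
  hits z y = b2n G ⌊ y ≟ᶠ z ⌋

  count : Fin n → List (Fin n) → ℕ
  count z l = sum (map (hits z) l)

  count-∉ : ∀ z l → ¬ z ∈ˡ l → count z l ≡ 0
  count-∉ z [] _ = refl
  count-∉ z (y ∷ l) z∉ with y ≟ᶠ z
  ... | yes refl = ⊥-elim (z∉ (here refl))
  ... | no _ = count-∉ z l (z∉ ∘ there)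

  count-unique : ∀ z l → Unique l → count z l ≡ 0 ⊎ count z l ≡ 1
  count-unique z [] _ = inj₁ refl
  count-unique z (y ∷ l) (y∉ ∷ ul) with y ≟ᶠ z
  ... | yes refl = inj₂ (cong suc (count-∉ z l (All¬⇒¬Any y∉)))
  ... | no _ = count-unique z l ul

  endCount-joins : ∀ {e v w} z → Joins G e v w → endCount G z e ≡ hits z v + hits z w
  endCount-joins z (inj₁ refl) = refl
  endCount-joins {v = v} {w} z (inj₂ refl) = +-comm (hits z w) (hits z v)

  -- Each visit of the walk to z accounts for two edge ends at z, except at the two ends of the walk.
  walk-endCount : ∀ {P u v} z (p : Walk P u v) →
    sum (map (endCount G z) (edges p)) + (hits z u + hits z v) ≡ 2 * count z (vertices p)
  walk-endCount {u = u} z nil = solve 1 (λ a → a :+ a := con 2 :* (a :+ con 0)) refl (hits z u)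
  walk-endCount {u = u} z (snoc {v = v} {w} p _ _ j) rewrite endCount-joins z j =
    arith (hits z v) (hits z w) (sum (map (endCount G z) (edges p))) (hits z u) (count z (vertices p))
         (walk-endCount z p)
    where
    arith : ∀ a b s c k → s + (c + a) ≡ 2 * k → ((a + b) + s) + (c + b) ≡ 2 * (b + k)
    arith a b s c k eq = begin
      ((a + b) + s) + (c + b)  ≡⟨ solve 4 (λ a b s c → ((a :+ b) :+ s) :+ (c :+ b) := (s :+ (c :+ a)) :+ con 2 :* b)
                                          refl a b s c ⟩
      (s + (c + a)) + 2 * b    ≡⟨ cong (_+ 2 * b) eq ⟩
      2 * k + 2 * b            ≡⟨ solve 2 (λ b k → con 2 :* k :+ con 2 :* b := con 2 :* (b :+ k)) refl b k ⟩
      2 * (b + k) ∎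

  degree-subsetOf : ∀ l z → Unique l → degree G (subsetOf (_∈ˡ? l)) z ≡ sum (map (endCount G z) l)
  degree-subsetOf l z ul = begin
    degree G S z                               ≡⟨ sum-map-allFin (λ e → Vec.lookup S e · endCount G z e) ⟩
    ∑ (λ e → Vec.lookup S e · endCount G z e)  ≡⟨ sum-cong-≗ {m} lookup-S ⟩
    ∑ (λ e → does (e ∈ˡ? l) · endCount G z e)  ≡⟨ ∑-indicator (endCount G z) l ul ⟩
    sum (map (endCount G z) l) ∎
    where
    S = subsetOf (_∈ˡ? l)
    lookup-S : ∀ e → Vec.lookup S e · endCount G z e ≡ does (e ∈ˡ? l) · endCount G z e
    lookup-S e = cong (_· endCount G z e) (lookup∘tabulate (does ∘ (_∈ˡ? l)) e)

  cycleOf : ∀ {P} (g : Fin m) → Walk P (proj₁ (ends g)) (proj₂ (ends g)) → Subset m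
  cycleOf g p = subsetOf (_∈ˡ? g ∷ edges p)

  ∈-cycleOf : ∀ {P} g (p : Walk P (proj₁ (ends g)) (proj₂ (ends g))) {e} → e ∈ cycleOf g p → e ≡ g ⊎ P e
  ∈-cycleOf g p e∈ with ∈-subsetOf⁻ (_∈ˡ? g ∷ edges p) e∈
  ... | here e≡g = inj₁ e≡g
  ... | there e∈p = inj₂ (edge-satisfies p e∈p)

  cycleOf-isCycle : ∀ {P} g (p : Walk P (proj₁ (ends g)) (proj₂ (ends g))) →
    Unique (vertices p) → ¬ g ∈ˡ edges p → IsCycle G (cycleOf g p)
  cycleOf-isCycle g p up g∉p = (g , ∈-cycle (here refl)) , degree-0-or-2 , connected
    where
    ∈-cycle : ∀ {e} → e ∈ˡ g ∷ edges p → e ∈ cycleOf g p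
    ∈-cycle = ∈-subsetOf⁺ (_∈ˡ? g ∷ edges p)

    ug : Unique (g ∷ edges p)
    ug = ¬Any⇒All¬ _ g∉p ∷ unique-edges p up

    degree-0-or-2 : ∀ z → degree G (cycleOf g p) z ≡ 0 ⊎ degree G (cycleOf g p) z ≡ 2
    degree-0-or-2 z rewrite degree-subsetOf (g ∷ edges p) z ug
                          | +-comm (endCount G z g) (sum (map (endCount G z) (edges p)))
                          | walk-endCount z p
                          with count-unique z (vertices p) up
    ... | inj₁ eq rewrite eq = inj₁ refl
    ... | inj₂ eq rewrite eq = inj₂ refl

    on-path : ∀ {e u} → e ∈ cycleOf g p → IncidentTo G u e → u ∈ˡ vertices p
    on-path e∈ u∼e with ∈-subsetOf⁻ (_∈ˡ? g ∷ edges p) e∈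
    on-path _ (inj₁ refl) | here refl = first∈ p
    on-path _ (inj₂ refl) | here refl = last∈ p
    ... | there e∈p = incident-vertices p e∈p u∼e

    from-start : ∀ {u} → u ∈ˡ vertices p → Walk (_∈ cycleOf g p) (proj₁ (ends g)) u
    from-start u∈ = relax (∈-cycle ∘ there) (prefix p u∈)

    connected : ∀ u v e f → e ∈ cycleOf g p → f ∈ cycleOf g p →
      IncidentTo G u e → IncidentTo G v f → Reach G (cycleOf g p) u v
    connected u v e f e∈ f∈ u∼e v∼f =
      toReach (reverse (from-start (on-path e∈ u∼e)) ++ from-start (on-path f∈ v∼f))

-- Nested families of bipartitions

module LaminarCuts {V K : Set} (side : K → V → Bool) where

  Separates : K → V → V → Set
  Separates k u v = side k u ≢ side k v

  ¬separates⇒≡ : ∀ {k u v} → ¬ Separates k u v → side k u ≡ side k v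
  ¬separates⇒≡ {k} {u} {v} = decidable-stable (side k u Bool.≟ side k v)

  separates-sym : ∀ {k u v} → Separates k u v → Separates k v u
  separates-sym k∣uv = k∣uv ∘ sym

  separates-trans : ∀ {k u v w} → Separates k u v → Separates k v w → side k u ≡ side k w
  separates-trans u≢v v≢w = trans (¬-not u≢v) (sym (¬-not (v≢w ∘ sym)))

  separates? : ∀ k u v → Dec (Separates k u v)
  separates? k u v = ¬? (side k u Bool.≟ side k v)

  separates-resp : ∀ {k u u′ w} → ¬ Separates k u u′ → Separates k u w → Separates k u′ w
  separates-resp ¬uu′ uw u′≡w = uw (trans (¬separates⇒≡ ¬uu′) u′≡w)

  separates-flip : ∀ {k u u′ w} → Separates k u u′ → ¬ Separates k u w → Separates k u′ w
  separates-flip uu′ ¬uw u′≡w = uu′ (trans (¬separates⇒≡ ¬uw) (sym u′≡w))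

  separates-unflip : ∀ {k u u′ w} → Separates k u u′ → Separates k u w → ¬ Separates k u′ w
  separates-unflip uu′ uw u′w = u′w (separates-trans (separates-sym uu′) uw)

  module Rooted (p : V) where

    Below : K → V → Set
    Below k = Separates k p

    _⊑_ : K → K → Set
    k ⊑ k′ = ∀ {w} → Below k w → Below k′ w

    below-¬separates : ∀ {k u v} → Below k u → ¬ Separates k u v → Below k v
    below-¬separates pu ¬uv pv = pu (trans pv (sym (¬separates⇒≡ ¬uv)))

    below-below : ∀ {k u v} → Below k u → Below k v → ¬ Separates k u v
    below-below pu pv uv = uv (separates-trans (separates-sym pu) pv)

    separates-¬below : ∀ {k u v} → Separates k u v → ¬ Below k v → Below k u
    separates-¬below uv ¬pv pu = uv (trans (sym pu) (¬separates⇒≡ ¬pv))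

    below-¬below : ∀ {k u v} → Below k u → ¬ Below k v → Separates k u v
    below-¬below pu ¬pv uv = pu (trans (¬separates⇒≡ ¬pv) (sym uv))

    module Configuration {Admissible : K → Set}
      (nested : ∀ {k k′ d} → Admissible k → Admissible k′ → Below k d → Below k′ d → k ⊑ k′ ⊎ k′ ⊑ k)
      {x y : K} (x-adm : Admissible x) (y-adm : Admissible y)
      (disjoint : ∀ {w} → Below y w → ¬ Below x w) {q : V} (q-x : Below x q) where

      Spans : V → V → Set
      Spans u v = Below x u × Below y v

      ⊑-x : ∀ {k a b a′ b′} → Spans a b → Spans a′ b′ →
        Admissible k → Below k q → Separates k a b → ¬ Separates k a′ b′ → k ⊑ x
      ⊑-x {k} (a-x , b-y) (a′-x , b′-y) k-adm q-k ab ¬a′b′ with nested k-adm x-adm q-k q-x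
      ... | inj₁ k⊑x = k⊑x
      ... | inj₂ x⊑k with nested k-adm y-adm (below-¬separates (x⊑k a′-x) ¬a′b′) b′-y
      ... | inj₁ k⊑y = ⊥-elim (disjoint (k⊑y q-k) q-x)
      ... | inj₂ y⊑k = ⊥-elim (below-below (x⊑k a-x) (y⊑k b-y) ab)

      private
        separates-larger : ∀ {k k′ u v} → k ⊑ k′ → k′ ⊑ x → Below y v →
          Separates k u v → ¬ Separates k′ u v → ⊥
        separates-larger k⊑k′ k′⊑x v-y uv ¬uv = ¬uv (below-¬below u-k′ v-¬k′)
          where
          v-¬k′ = λ v-k′ → disjoint v-y (k′⊑x v-k′)
          u-k′ = k⊑k′ (separates-¬below uv (v-¬k′ ∘ k⊑k′))

      -- Both k and k′ lie below x, so they are nested; the smaller one cannot separate a pair that the larger does not.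
      no-switch : ∀ {k k′ a b a′ b′} → Spans a b → Spans a′ b′ →
        Admissible k → Admissible k′ → Below k q → Below k′ q →
        Separates k a b → ¬ Separates k a′ b′ → Separates k′ a′ b′ → ¬ Separates k′ a b → ⊥
      no-switch ab-xy a′b′-xy k-adm k′-adm q-k q-k′ ab ¬a′b′ a′b′ ¬ab
        with nested k-adm k′-adm q-k q-k′
      ... | inj₁ k⊑k′ = separates-larger k⊑k′ (⊑-x a′b′-xy ab-xy k′-adm q-k′ a′b′ ¬ab) (proj₂ ab-xy) ab ¬ab
      ... | inj₂ k′⊑k = separates-larger k′⊑k (⊑-x ab-xy a′b′-xy k-adm q-k ab ¬a′b′) (proj₂ a′b′-xy) a′b′ ¬a′b′

-- The cuts of a spanning tree

module SpanningTree (G : Graph) (T : Subset (Graph.m G)) (tree : IsSpanningTree G T) where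
  open Graph G
  open Walks G

  end : Fin m → Bool → Fin n
  end k false = proj₁ (ends k)
  end k true  = proj₂ (ends k)

  joins-ends : ∀ k → Joins G k (end k false) (end k true)
  joins-ends k = inj₁ refl

  T∖_ : Fin m → Fin m → Set
  T∖ k = (_∈ T) ∖ k

  tree-walk : ∀ u v → Walk (_∈ T) u v
  tree-walk u v = fromReach (proj₁ tree u v)

  no-bypass : ∀ {k} → k ∈ T → ¬ Walk (T∖ k) (end k false) (end k true)
  no-bypass {k} k∈T w with simplify w
  ... | q , uq = proj₂ tree (cycleOf k q) ⊆T (cycleOf-isCycle k q uq (λ k∈q → proj₂ (edge-satisfies q k∈q) refl))
    where
    ⊆T : cycleOf k q ⊆ T
    ⊆T e∈ with ∈-cycleOf k q e∈
    ... | inj₁ refl = k∈T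
    ... | inj₂ (e∈T , _) = e∈T

  truncate : ∀ k {u v} → Walk (_∈ T) u v → Walk (T∖ k) u v ⊎ ∃ λ b → Walk (T∖ k) u (end k b)
  truncate k nil = inj₁ nil
  truncate k (snoc p e e∈T j) with truncate k p
  ... | inj₂ r = inj₂ r
  ... | inj₁ r with e ≟ᶠ k
  ... | no e≢k = inj₁ (snoc r e (e∈T , e≢k) j)
  ... | yes refl with joins-incidentˡ j
  ... | inj₁ refl = inj₂ (false , r)
  ... | inj₂ refl = inj₂ (true , r)

  toward : ∀ k w → ∃ λ b → Walk (T∖ k) w (end k b)
  toward k w with truncate k (tree-walk w (end k false))
  ... | inj₁ r = false , r
  ... | inj₂ r = r

  -- The side of k on which w lies: the end of k reached from w in the tree without using k.
  side : Fin m → Fin n → Bool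
  side k w = proj₁ (toward k w)

  to-side : ∀ k w → Walk (T∖ k) w (end k (side k w))
  to-side k w = proj₂ (toward k w)

  open LaminarCuts side public

  ≡side⇒walk : ∀ {k u v} → side k u ≡ side k v → Walk (T∖ k) u v
  ≡side⇒walk {k} {u} {v} eq =
    to-side k u ++ reverse (subst (λ b → Walk (T∖ k) v (end k b)) (sym eq) (to-side k v))

  walk⇒≡side : ∀ {k u v} → k ∈ T → Walk (T∖ k) u v → side k u ≡ side k v
  walk⇒≡side {k} {u} {v} k∈T p with side k u | to-side k u | side k v | to-side k v
  ... | false | _ | false | _ = refl
  ... | true | _ | true | _ = refl
  ... | false | pu | true | pv = ⊥-elim (no-bypass k∈T (reverse pu ++ p ++ pv))
  ... | true | pu | false | pv = ⊥-elim (no-bypass k∈T (reverse pv ++ reverse p ++ pu))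

  separates-ends : ∀ {k} → k ∈ T → Separates k (end k false) (end k true)
  separates-ends k∈T = no-bypass k∈T ∘ ≡side⇒walk

  separates-joins : ∀ {k s t} → k ∈ T → Joins G k s t → Separates k s t
  separates-joins k∈T (inj₁ refl) = separates-ends k∈T
  separates-joins k∈T (inj₂ refl) = separates-sym (separates-ends k∈T)

  side-joins : ∀ {k e v w} → k ∈ T → e ∈ T → e ≢ k → Joins G e v w → side k v ≡ side k w
  side-joins k∈T e∈T e≢k j = walk⇒≡side k∈T (snoc nil _ (e∈T , e≢k) j)

  avoid-far-edge : ∀ {k k′ u v} → k ∈ T → (∀ b → Separates k u (end k′ b)) →
    Walk (T∖ k) u v → Walk (T∖ k′) u v
  avoid-far-edge k∈T far nil = nil
  avoid-far-edge k∈T far (snoc p e (e∈T , e≢k) j) = snoc (avoid-far-edge k∈T far p) e (e∈T , e≢k′) j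
    where
    e≢k′ : e ≢ _
    e≢k′ refl with joins-incidentˡ j
    ... | inj₁ refl = far false (walk⇒≡side k∈T p)
    ... | inj₂ refl = far true (walk⇒≡side k∈T p)

  side-of-edge : ∀ {k k′} → k ∈ T → k′ ∈ T → k ≢ k′ → ∀ b → side k (end k′ b) ≡ side k (end k′ false)
  side-of-edge k∈T k′∈T k≢k′ false = refl
  side-of-edge k∈T k′∈T k≢k′ true = sym (side-joins k∈T k′∈T (k≢k′ ∘ sym) (joins-ends _))

  nested : ∀ c {k k′ d} → k ∈ T → k′ ∈ T → Separates k c d → Separates k′ c d →
    Rooted._⊑_ c k k′ ⊎ Rooted._⊑_ c k′ k
  nested c {k} {k′} {d} k∈T k′∈T c∣d c∣′d with k ≟ᶠ k′
  ... | yes refl = inj₁ (λ c∣w → c∣w)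
  ... | no k≢k′ with side k (end k′ false) Bool.≟ side k c
  ... | yes k′-near =
    inj₁ λ c∣w c≡w → c∣′d (trans c≡w (walk⇒≡side k′∈T (avoid-far-edge k∈T (far c∣w)
      (≡side⇒walk (separates-trans (separates-sym c∣w) c∣d)))))
    where
    far : ∀ {w} → Separates k c w → ∀ b → Separates k w (end k′ b)
    far c∣w b w≡ = c∣w (sym (trans w≡ (trans (side-of-edge k∈T k′∈T k≢k′ b) k′-near)))
  ... | no k′-far =
    inj₂ λ c∣′w c≡w → c∣′w (walk⇒≡side k′∈T (avoid-far-edge k∈T far (≡side⇒walk c≡w)))
    where
    far : ∀ b → Separates k c (end k′ b)
    far b c≡ = k′-far (sym (trans c≡ (side-of-edge k∈T k′∈T k≢k′ b)))

  Crosses : Fin m → Fin m → Set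
  Crosses k e = Separates k (end e false) (end e true)

  crosses⇒separates : ∀ {k e s t} → Joins G e s t → Crosses k e → Separates k s t
  crosses⇒separates (inj₁ refl) = λ k∣e → k∣e
  crosses⇒separates (inj₂ refl) = separates-sym

  separates⇒crosses : ∀ {k e s t} → Joins G e s t → Separates k s t → Crosses k e
  separates⇒crosses (inj₁ refl) = λ k∣st → k∣st
  separates⇒crosses (inj₂ refl) = separates-sym

  tree-path : ∀ e → Σ (Walk (_∈ T) (end e false) (end e true)) (Unique ∘ vertices)
  tree-path e = simplify (tree-walk _ _)

  fundamental : Fin m → Subset m
  fundamental e = cycleOf e (proj₁ (tree-path e))

  ∈-fundamental : ∀ {k e} → k ∈ fundamental e → k ≡ e ⊎ k ∈ T
  ∈-fundamental {e = e} = ∈-cycleOf e (proj₁ (tree-path e))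

  fundamental-isFundamentalCycle : ∀ {e} → e ∉ T → IsFundamentalCycle G T e (fundamental e)
  fundamental-isFundamentalCycle {e} e∉T =
    e∉T , cycleOf-isCycle e q uq (e∉T ∘ edge-satisfies q) , ⊆T∪e
    where
    q = proj₁ (tree-path e)
    uq = proj₂ (tree-path e)
    ⊆T∪e : fundamental e ⊆ T ∪ ⁅ e ⁆
    ⊆T∪e k∈ with ∈-fundamental k∈
    ... | inj₁ refl = x∈p∪q⁺ (inj₂ (x∈⁅x⁆ e))
    ... | inj₂ k∈T = x∈p∪q⁺ (inj₁ k∈T)

  crosses⇒∈fundamental : ∀ {k e} → k ∈ T → Crosses k e → k ∈ fundamental e
  crosses⇒∈fundamental {k} {e} k∈T k∣e with k ∈ˡ? edges (proj₁ (tree-path e))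
  ... | yes k∈q = ∈-subsetOf⁺ (_∈ˡ? e ∷ edges _) (there k∈q)
  ... | no k∉q = ⊥-elim (k∣e (walk⇒≡side k∈T (avoiding (proj₁ (tree-path e)) k∉q)))

  ∈fundamental⇒crosses : ∀ {k e} → k ∈ T → e ∉ T → k ∈ fundamental e → Crosses k e
  ∈fundamental⇒crosses {k} {e} k∈T e∉T k∈ with ∈-subsetOf⁻ (_∈ˡ? e ∷ edges (proj₁ (tree-path e))) k∈
  ... | here refl = ⊥-elim (e∉T k∈T)
  ... | there k∈q with split (proj₁ (tree-path e)) (unique-edges _ (proj₂ (tree-path e))) k∈q
  ... | s , t , j , p₁ , p₂ =
    λ side≡ → separates-joins k∈T j (trans (sym (walk⇒≡side k∈T p₁)) (trans side≡ (sym (walk⇒≡side k∈T p₂))))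

  crossing-orientation : ∀ c {k e} → Crosses k e →
    ∃₂ λ s t → Joins G e s t × ¬ Separates k c s × Separates k c t
  crossing-orientation c {k} {e} k∣e with separates? k c (end e false)
  ... | yes c∣s = _ , _ , inj₂ refl , (λ c∣t → separates-unflip c∣s c∣t k∣e) , c∣s
  ... | no ¬c∣s = _ , _ , inj₁ refl , ¬c∣s , separates-resp (¬c∣s ∘ separates-sym) k∣e

-- Shrinking the common tree part of two fundamental cycles

module ThreeEdgeConnectedTree (G : Graph) (tec : ThreeEdgeConnected G)
  (T : Subset (Graph.m G)) (tree : IsSpanningTree G T) where
  open Graph G
  open Walks G
  open SpanningTree G T tree public

  exit-edge-avoiding : ∀ {M : Fin n → Set} → Decidable M → (F : Subset m) → ∣ F ∣ ≤ 2 →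
    ∀ {u v} → M u → ¬ M v → ∃ λ e → ∃₂ λ s t → e ∉ F × Joins G e s t × M s × ¬ M t
  exit-edge-avoiding M? F ∣F∣≤2 Mu ¬Mv with exit-edge M? (fromReach (proj₂ tec F ∣F∣≤2 _ _)) Mu ¬Mv
  ... | e , s , t , e∈ , rest = e , s , t , x∈p─q⇒x∉q ⊤ F e∈ , rest

  crossing-nontree : ∀ {g} → g ∈ T → (F : Subset m) → ∣ F ∣ ≤ 2 → g ∈ F →
    ∃ λ e → e ∉ F × e ∉ T × Crosses g e
  crossing-nontree {g} g∈T F ∣F∣≤2 g∈F
    with exit-edge-avoiding (λ w → ¬? (separates? g (end g false) w)) F ∣F∣≤2 (λ g∣ → g∣ refl)
           (λ ¬g∣ → ¬g∣ (separates-ends g∈T))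
  ... | e , s , t , e∉F , j , ¬g∣s , ¬¬g∣t = e , e∉F , e∉T , separates⇒crosses j s∣t
    where
    s∣t : Separates g s t
    s∣t = separates-resp ¬g∣s (decidable-stable (separates? g _ t) ¬¬g∣t)
    e∉T : e ∉ T
    e∉T e∈T = s∣t (side-joins g∈T e∈T (λ { refl → e∉F g∈F }) j)

  OnTreePath : Fin m → Fin m → Set
  OnTreePath e k = k ∈ T × Crosses k e

  onTreePath? : ∀ e → Decidable (OnTreePath e)
  onTreePath? e k = (k ∈? T) ×-dec separates? k (end e false) (end e true)

  -- The tree edges of ci(e, T), see crosses⇒∈fundamental and ∈fundamental⇒crosses.
  treePath : Fin m → Subset m
  treePath e = subsetOf (onTreePath? e)

  ∈-treePath⁺ : ∀ {k e} → k ∈ T → Crosses k e → k ∈ treePath e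
  ∈-treePath⁺ k∈T k∣e = ∈-subsetOf⁺ (onTreePath? _) (k∈T , k∣e)

  ∈-treePath⁻ : ∀ {k e} → k ∈ treePath e → k ∈ T × Crosses k e
  ∈-treePath⁻ = ∈-subsetOf⁻ (onTreePath? _)

  ∉-treePath : ∀ {k e s t} → k ∈ T → k ∉ treePath e → Joins G e s t → ¬ Separates k s t
  ∉-treePath k∈T k∉ j k∣st = k∉ (∈-treePath⁺ k∈T (separates⇒crosses j k∣st))

  shared : Fin m × Fin m → Subset m
  shared (e₁ , e₂) = treePath e₁ ∩ treePath e₂

  ∈-shared⁻ : ∀ {k e₁ e₂} → k ∈ shared (e₁ , e₂) → k ∈ T × Crosses k e₁ × Crosses k e₂
  ∈-shared⁻ {e₁ = e₁} {e₂} k∈ with x∈p∩q⁻ (treePath e₁) (treePath e₂) k∈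
  ... | k∈₁ , k∈₂ = proj₁ (∈-treePath⁻ k∈₁) , proj₂ (∈-treePath⁻ k∈₁) , proj₂ (∈-treePath⁻ k∈₂)

  Candidate : Fin m × Fin m → Set
  Candidate (e₁ , e₂) = e₁ ∉ T × e₂ ∉ T × e₁ ≢ e₂ × Nonempty (shared (e₁ , e₂))

  Improves : Fin m × Fin m → Set
  Improves c = ∃ λ c′ → Candidate c′ × shared c′ ⊂ shared c

  module _ {p q : Fin n} {x y : Fin m} (x∈T : x ∈ T) (y∈T : y ∈ T)
    (disjoint : ∀ {w} → Rooted.Below p y w → ¬ Rooted.Below p x w) (q-x : Rooted.Below p x q) where
    open Rooted p
    open Configuration (nested p) x∈T y∈T disjoint q-x

    spans-x : ∀ {e a b} → Joins G e a b → Spans a b → x ∈ treePath e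
    spans-x j (a-x , b-y) = ∈-treePath⁺ x∈T (separates⇒crosses j (below-¬below a-x (disjoint b-y)))

    spans-y : ∀ {e a b} → Joins G e a b → Spans a b → y ∈ treePath e
    spans-y j (a-x , b-y) =
      ∈-treePath⁺ y∈T (separates⇒crosses j (separates-sym (below-¬below b-y (λ a-y → disjoint a-y a-x))))

    replace : ∀ {e₁ e₂ e₃ a b a′ b′} → e₁ ∉ T → e₂ ∉ T → e₃ ∉ T → Joins G e₃ p q →
      Joins G e₁ a b → Spans a b → Joins G e₂ a′ b′ → Spans a′ b′ → Improves (e₁ , e₂)
    replace {e₁} {e₂} {e₃} e₁∉T e₂∉T e₃∉T j₃ j₁ ab-xy j₂ a′b′-xy =
      [ (λ ⊂₁ → (e₃ , e₁) , (e₃∉T , e₁∉T , e₃≢ (spans-y j₁ ab-xy) , x , x∈p∩q⁺ (x∈₃ , spans-x j₁ ab-xy)) , ⊂₁)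
      , (λ ⊂₂ → (e₃ , e₂) , (e₃∉T , e₂∉T , e₃≢ (spans-y j₂ a′b′-xy) , x , x∈p∩q⁺ (x∈₃ , spans-x j₂ a′b′-xy)) , ⊂₂)
      ] (exchange (treePath e₁) (treePath e₂) (treePath e₃) no-switch′ y∈₁₂ y∉₃)
      where
      x∈₃ : x ∈ treePath e₃
      x∈₃ = ∈-treePath⁺ x∈T (separates⇒crosses j₃ q-x)
      y∈₁₂ : y ∈ treePath e₁ ∩ treePath e₂
      y∈₁₂ = x∈p∩q⁺ (spans-y j₁ ab-xy , spans-y j₂ a′b′-xy)
      y∉₃ : y ∉ treePath e₃
      y∉₃ y∈ = disjoint (crosses⇒separates j₃ (proj₂ (∈-treePath⁻ y∈))) q-x
      e₃≢ : ∀ {e} → y ∈ treePath e → e₃ ≢ e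
      e₃≢ y∈ refl = y∉₃ y∈
      no-switch′ : ∀ {i j} → i ∈ treePath e₃ ∩ treePath e₁ → i ∉ treePath e₂ →
        j ∈ treePath e₃ ∩ treePath e₂ → j ∉ treePath e₁ → ⊥
      no-switch′ i∈ i∉₂ j∈ j∉₁ with ∈-shared⁻ i∈ | ∈-shared⁻ j∈
      ... | i∈T , i∣e₃ , i∣e₁ | j∈T , j∣e₃ , j∣e₂ =
        no-switch ab-xy a′b′-xy i∈T j∈T (crosses⇒separates j₃ i∣e₃) (crosses⇒separates j₃ j∣e₃)
          (crosses⇒separates j₁ i∣e₁) (∉-treePath i∈T i∉₂ j₂)
          (crosses⇒separates j₂ j∣e₂) (∉-treePath j∈T j∉₁ j₁)

  module _ {e₁ e₂ g h} (e₁∉T : e₁ ∉ T) (e₂∉T : e₂ ∉ T) (g∈T : g ∈ T) (h∈T : h ∈ T) (g≢h : g ≢ h)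
    (h-e₁ : Crosses h e₁) (g-e₂ : Crosses g e₂) (h-e₂ : Crosses h e₂) where
    open Rooted (end e₁ false)

    -- Seen from an end of e₁ with h below g, the tree edges leaving the region between g and h are just g and h,
    -- so by 3-edge-connectivity a non-tree edge e₃ leaves it too; it crosses exactly one of g and h.
    Middle : Fin n → Set
    Middle w = Below g w × ¬ Below h w

    middle? : Decidable Middle
    middle? w = separates? g _ w ×-dec ¬? (separates? h _ w)

    module _ (h⊑g : h ⊑ g) where

      middle-end : ∃ Middle
      middle-end with crossing-orientation (end e₁ false) (separates-ends g∈T)
      ... | s , t , j , ¬s-g , t-g =
        t , t-g , λ t-h → ¬s-g (h⊑g (below-¬separates t-h (λ t∣s → t∣s (sym (side-joins h∈T g∈T g≢h j)))))

      nontree-exit : ∀ {e₃ p q} → e₃ ∉ ⁅ g ⁆ ∪ ⁅ h ⁆ → Joins G e₃ p q → Middle p → ¬ Middle q → e₃ ∉ T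
      nontree-exit {e₃} e₃∉F j₃ (p-g , p-¬h) ¬Mq e₃∈T =
        ¬Mq (below-¬separates p-g (λ pq → pq (side-joins g∈T e₃∈T e₃≢g j₃)) ,
             λ q-h → p-¬h (below-¬separates q-h (λ qp → qp (sym (side-joins h∈T e₃∈T e₃≢h j₃)))))
        where
        e₃≢g : e₃ ≢ g
        e₃≢g refl = e₃∉F (x∈p∪q⁺ (inj₁ (x∈⁅x⁆ g)))
        e₃≢h : e₃ ≢ h
        e₃≢h refl = e₃∉F (x∈p∪q⁺ (inj₂ (x∈⁅x⁆ h)))

      below-h : ∀ {a₂ b₂} → Joins G e₂ a₂ b₂ → ¬ Below g a₂ → Below h b₂
      below-h j₂ ¬a₂-g = separates-resp (λ a₂∣a → ¬a₂-g (h⊑g (separates-sym a₂∣a))) (crosses⇒separates j₂ h-e₂)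

      module Rerooted {p : Fin n} (p-g : Below g p) (p-¬h : ¬ Below h p) where

        into-h : ∀ {w} → Below h w → Rooted.Below p h w
        into-h = separates-resp p-¬h

        into-g : ∀ {w} → ¬ Below g w → Rooted.Below p g w
        into-g = separates-flip p-g

        apart : ∀ {w} → Rooted.Below p h w → ¬ Rooted.Below p g w
        apart ph pg = separates-unflip p-g (h⊑g (separates-resp (p-¬h ∘ separates-sym) ph)) pg

        from-exit : ∀ {e₃ q a₂ b₂} → e₃ ∉ T → Joins G e₃ p q → ¬ Middle q →
          Joins G e₂ a₂ b₂ → ¬ Below g a₂ → Improves (e₁ , e₂)
        from-exit {q = q} e₃∉T j₃ ¬Mq j₂ ¬a₂-g with separates? g _ q
        ... | yes q-g =
          replace h∈T g∈T (λ pg ph → apart ph pg)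
            (into-h (decidable-stable (separates? h _ q) (λ ¬q-h → ¬Mq (q-g , ¬q-h))))
            e₁∉T e₂∉T e₃∉T j₃ (inj₂ refl) (into-h h-e₁ , into-g (λ a-g → a-g refl))
            (joins-sym j₂) (into-h (below-h j₂ ¬a₂-g) , into-g ¬a₂-g)
        ... | no ¬q-g =
          replace g∈T h∈T apart (into-g ¬q-g)
            e₁∉T e₂∉T e₃∉T j₃ (inj₁ refl) (into-g (λ a-g → a-g refl) , into-h h-e₁)
            j₂ (into-g ¬a₂-g , into-h (below-h j₂ ¬a₂-g))

      shrink-nested : Improves (e₁ , e₂)
      shrink-nested =
        conclude (exit-edge-avoiding middle? (⁅ g ⁆ ∪ ⁅ h ⁆) (∣⁅x⁆∪⁅y⁆∣≤2 g h) (proj₂ middle-end) (λ a∈M → proj₁ a∈M refl))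
                 (crossing-orientation (end e₁ false) g-e₂)
        where
        conclude : (∃ λ e₃ → ∃₂ λ p q → e₃ ∉ ⁅ g ⁆ ∪ ⁅ h ⁆ × Joins G e₃ p q × Middle p × ¬ Middle q) →
          (∃₂ λ a₂ b₂ → Joins G e₂ a₂ b₂ × ¬ Below g a₂ × Below g b₂) → Improves (e₁ , e₂)
        conclude (e₃ , p , q , e₃∉F , j₃ , Mp , ¬Mq) (a₂ , b₂ , j₂ , ¬a₂-g , _) =
          Rerooted.from-exit (proj₁ Mp) (proj₂ Mp) (nontree-exit e₃∉F j₃ Mp ¬Mq) j₃ ¬Mq j₂ ¬a₂-g

  shrink : ∀ {e₁ e₂ g h} → e₁ ∉ T → e₂ ∉ T → g ∈ shared (e₁ , e₂) → h ∈ shared (e₁ , e₂) → g ≢ h →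
    Improves (e₁ , e₂)
  shrink e₁∉T e₂∉T g∈ h∈ g≢h =
    let g∈T , g-e₁ , g-e₂ = ∈-shared⁻ g∈
        h∈T , h-e₁ , h-e₂ = ∈-shared⁻ h∈
    in [ shrink-nested e₁∉T e₂∉T h∈T g∈T (g≢h ∘ sym) g-e₁ h-e₂ g-e₂
       , shrink-nested e₁∉T e₂∉T g∈T h∈T g≢h h-e₁ g-e₂ h-e₂
       ] (nested _ g∈T h∈T g-e₁ h-e₁)

  SharesOnly : Fin m → Fin m × Fin m → Set
  SharesOnly f c = shared c ≡ ⁅ f ⁆

  progress : ∀ {c} → Candidate c → (∃ λ f → SharesOnly f c) ⊎ ∃ λ c′ → Candidate c′ × ∣ shared c′ ∣ < ∣ shared c ∣
  progress {c} (e₁∉T , e₂∉T , _ , f , f∈) with any? (λ h → (h ∈? shared c) ×-dec ¬? (h ≟ᶠ f))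
  ... | yes (h , h∈ , h≢f) =
    let c′ , candidate , ⊂ = shrink e₁∉T e₂∉T h∈ f∈ h≢f in inj₂ (c′ , candidate , p⊂q⇒∣p∣<∣q∣ ⊂)
  ... | no none = inj₁ (f , ⊆-antisym ⊆⁅f⁆ (λ h∈ → subst (_∈ shared c) (sym (x∈⁅y⁆⇒x≡y f h∈)) f∈))
    where
    ⊆⁅f⁆ : shared c ⊆ ⁅ f ⁆
    ⊆⁅f⁆ {h} h∈ = subst (_∈ ⁅ f ⁆) (sym (decidable-stable (h ≟ᶠ f) (λ h≢f → none (h , h∈ , h≢f)))) (x∈⁅x⁆ f)

  initial-candidate : 2 ≤ n → ∃ Candidate
  initial-candidate 2≤n =
    let u , v , u≢v = two-elements 2≤n
        g , g∈T = first-edge (tree-walk u v) u≢v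
        e₁ , _ , e₁∉T , g-e₁ = crossing-nontree g∈T ⁅ g ⁆ (≤-trans (≤-reflexive (∣⁅x⁆∣≡1 g)) (s≤s z≤n)) (x∈⁅x⁆ g)
        e₂ , e₂∉F , e₂∉T , g-e₂ =
          crossing-nontree g∈T (⁅ g ⁆ ∪ ⁅ e₁ ⁆) (∣⁅x⁆∪⁅y⁆∣≤2 g e₁) (x∈p∪q⁺ (inj₁ (x∈⁅x⁆ g)))
    in (e₁ , e₂) , e₁∉T , e₂∉T , (λ e₁≡e₂ → e₂∉F (x∈p∪q⁺ (inj₂ (subst (_∈ ⁅ e₁ ⁆) e₁≡e₂ (x∈⁅x⁆ e₁))))) ,
       g , x∈p∩q⁺ (∈-treePath⁺ g∈T g-e₁ , ∈-treePath⁺ g∈T g-e₂)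

  fundamental-∩ : ∀ {e₁ e₂ f} → Candidate (e₁ , e₂) → SharesOnly f (e₁ , e₂) →
    fundamental e₁ ∩ fundamental e₂ ≡ ⁅ f ⁆
  fundamental-∩ {e₁} {e₂} {f} (e₁∉T , e₂∉T , e₁≢e₂ , _) shared≡ = ⊆-antisym ⊆⁅f⁆ ⁅f⁆⊆
    where
    ∩⊆T : ∀ {k} → k ∈ fundamental e₁ → k ∈ fundamental e₂ → k ∈ T
    ∩⊆T k∈₁ k∈₂ with ∈-fundamental k∈₁ | ∈-fundamental k∈₂
    ... | inj₁ refl | inj₁ refl = ⊥-elim (e₁≢e₂ refl)
    ... | inj₂ k∈T | _ = k∈T
    ... | inj₁ _ | inj₂ k∈T = k∈T

    ⊆⁅f⁆ : fundamental e₁ ∩ fundamental e₂ ⊆ ⁅ f ⁆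
    ⊆⁅f⁆ {k} k∈ =
      let k∈₁ , k∈₂ = x∈p∩q⁻ (fundamental e₁) (fundamental e₂) k∈
          k∈T = ∩⊆T k∈₁ k∈₂
      in subst (k ∈_) shared≡ (x∈p∩q⁺ (∈-treePath⁺ k∈T (∈fundamental⇒crosses k∈T e₁∉T k∈₁) ,
                                       ∈-treePath⁺ k∈T (∈fundamental⇒crosses k∈T e₂∉T k∈₂)))

    ⁅f⁆⊆ : ⁅ f ⁆ ⊆ fundamental e₁ ∩ fundamental e₂
    ⁅f⁆⊆ k∈ =
      let f∈T , f-e₁ , f-e₂ = ∈-shared⁻ (subst (f ∈_) (sym shared≡) (x∈⁅x⁆ f))
      in subst (_∈ fundamental e₁ ∩ fundamental e₂) (sym (x∈⁅y⁆⇒x≡y f k∈))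
           (x∈p∩q⁺ (crosses⇒∈fundamental f∈T f-e₁ , crosses⇒∈fundamental f∈T f-e₂))

lemma3p7 : (G : Graph) → ThreeEdgeConnected G → 2 ≤ Graph.n G →
    (T : Subset (Graph.m G)) → IsSpanningTree G T →
    ∃ λ (e₁ : Fin (Graph.m G)) → ∃ λ (e₂ : Fin (Graph.m G)) →
    ∃ λ (C₁ : Subset (Graph.m G)) → ∃ λ (C₂ : Subset (Graph.m G)) →
    ∃ λ (f : Fin (Graph.m G)) →
    IsFundamentalCycle G T e₁ C₁ × IsFundamentalCycle G T e₂ C₂ ×
    (C₁ ∩ C₂ ≡ ⁅ f ⁆) × f ∈ T
lemma3p7 G tec 2≤n T tree =
  let open ThreeEdgeConnectedTree G tec T tree
      (e₁ , e₂) , candidate , f , shared≡ = descent (∣_∣ ∘ shared) progress (proj₂ (initial-candidate 2≤n))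
      e₁∉T , e₂∉T , _ = candidate
  in e₁ , e₂ , fundamental e₁ , fundamental e₂ , f ,
     fundamental-isFundamentalCycle e₁∉T , fundamental-isFundamentalCycle e₂∉T ,
     fundamental-∩ candidate shared≡ , proj₁ (∈-shared⁻ (subst (f ∈_) (sym shared≡) (x∈⁅x⁆ f)))
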